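{- For every Time Petri Net $N$ with a finite set of reachable markings, there is a 1-safe Time Petri Net $N^\times$ (every reachable marking puts at most one token in each place) whose state graph is weakly timed bisimilar to the state graph of $N$.
   Context: Let $\mathbb{I}$ be the set of real intervals $[a,b]$ or $[a,+\infty)$ with non-negative rational endpoints. A Time Petri Net is a tuple $\langle P,T,\mathrm{Pre},\mathrm{Post},m_0,\mathbf{I}_s\rangle$ with finite place and transition sets, $\mathrm{Pre},\mathrm{Post}:T\to P\to\mathbb{N}$, initial marking $m_0$, and static interval $\mathbf{I}_s(t)\in\mathbb{I}$ for each transition. $t$ is enabled at $m$ if $m\ge\mathrm{Pre}(t)$; $\mathcal{E}(m)$ is the set of enabled transitions; $k\in\mathcal{E}(m)\setminus\{t\}$ is persistent when $t$ fires if $m-\mathrm{Pre}(t)\ge\mathrm{Pre}(k)$. States are pairs $(m,\varphi)$ with $\varphi:\mathcal{E}(m)\to\mathbb{R}_{\ge0}$ (firing dates). Initial states: $(m_0,\varphi)$ with $\varphi(t)\in\mathbf{I}_s(t)$. Discrete step: if $t\in\mathcal{E}(m)$ and $\varphi(t)=0$ then $(m,\varphi)\xrightarrow{t}(m',\varphi')$ with $m'=m-\mathrm{Pre}(t)+\mathrm{Post}(t)$, $\varphi'(k)=\varphi(k)$ for persistent $k$, $\varphi'(k)\in\mathbf{I}_s(k)$ for all other $k\in\mathcal{E}(m')$. Time step: for $\theta\le\varphi(k)$ for all enabled $k$, $(m,\varphi)\xrightarrow{\theta}(m,\varphi-\theta)$. Weak timed bisimilarity: transitions of $N^\times$ are labelled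 by transitions of $N$ or by a silent label $\tau$; with $\Rightarrow^{\alpha}$ meaning $(\xrightarrow{\tau})^*\xrightarrow{\alpha}$ for $\alpha\ne\tau$ and $(\xrightarrow{\tau})^*$ for $\alpha=\tau$, a relation $R$ is a weak timed simulation if $s_1\xrightarrow{\alpha}s_1'$ and $s_1Rs_2$ imply some $s_2'$ with $s_2\Rightarrow^{\alpha}s_2'$ and $s_1'Rs_2'$; two systems are weakly timed bisimilar if some $R$ and $R^{ -1}$ are both weak timed simulations.
   Formalization: Firing dates and delays $\theta$ take values in the non-negative rationals instead of $\mathbb{R}_{\ge0}$. -}

module Defs where

open import Data.Nat using (ℕ; _∸_; _+_) renaming (_≤_ to _≤ℕ_)
open import Data.Fin using (Fin)
open import Data.Rational using (ℚ; 0ℚ; _≤_; _-_)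
open import Data.Maybe using (Maybe; just; nothing)
open import Data.List using (List)
open import Data.List.Relation.Unary.Any using (Any)
open import Data.Product using (Σ; _×_; ∃)
open import Data.Empty using (⊥)
open import Relation.Nullary using (¬_)
open import Relation.Binary.PropositionalEquality using (_≡_; _≢_)
open import Relation.Binary.Construct.Closure.ReflexiveTransitive using (Star)

-- Intervals [a,b] or [a,+∞) with non-negative rational endpoints
-- (hi = nothing encodes +∞).
record Interval : Set where
  field
    lo       : ℚ
    hi       : Maybe ℚ
    lo-nonneg : 0ℚ ≤ lo
    lo≤hi    : ∀ b → hi ≡ just b → lo ≤ b

_∈I_ : ℚ → Interval → Set
x ∈I I = Interval.lo I ≤ x × (∀ b → Interval.hi I ≡ just b → x ≤ b)

record TPN : Set where
  field
    nP   : ℕ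
    nT   : ℕ
    Pre  : Fin nT → Fin nP → ℕ
    Post : Fin nT → Fin nP → ℕ
    m₀   : Fin nP → ℕ
    Is   : Fin nT → Interval

module _ (N : TPN) where
  open TPN N

  Marking : Set
  Marking = Fin nP → ℕ

  Enabled : Marking → Fin nT → Set
  Enabled m t = ∀ p → Pre t p ≤ℕ m p

  Persistent : Marking → Fin nT → Fin nT → Set
  Persistent m t k = k ≢ t × Enabled m k × (∀ p → Pre k p ≤ℕ (m p ∸ Pre t p))

  -- A state (m, φ) with φ : E(m) → ℝ≥0, encoded as a total function that is
  -- forced to be 0 outside E(m) (a canonical encoding of the partial map).
  record State : Set where
    field
      mk       : Marking
      φ        : Fin nT → ℚ
      φ-nonneg : ∀ t → 0ℚ ≤ φ t
      φ-dis    : ∀ t → ¬ Enabled mk t → φ t ≡ 0ℚ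

  open State

  Initial : State → Set
  Initial s = (∀ p → mk s p ≡ m₀ p) × (∀ t → Enabled (mk s) t → φ s t ∈I Is t)

  Fire : State → Fin nT → State → Set
  Fire s t s' =
    Enabled (mk s) t × φ s t ≡ 0ℚ ×
    (∀ p → mk s' p ≡ (mk s p ∸ Pre t p) + Post t p) ×
    (∀ k → Enabled (mk s') k →
        (Persistent (mk s) t k → φ s' k ≡ φ s k) ×
        (¬ Persistent (mk s) t k → φ s' k ∈I Is k))

  Delay : State → ℚ → State → Set
  Delay s θ s' =
    0ℚ ≤ θ × (∀ k → Enabled (mk s) k → θ ≤ φ s k) ×
    (∀ p → mk s' p ≡ mk s p) ×
    (∀ k → Enabled (mk s) k → φ s' k ≡ φ s k - θ)

  AnyStep : State → State → Set
  AnyStep s s' = (∃ λ t → Fire s t s') ⊎' (∃ λ θ → Delay s θ s')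
    where
    open import Data.Sum renaming (_⊎_ to _⊎'_)

  Reachable : State → Set
  Reachable s = ∃ λ s₀ → Initial s₀ × Star AnyStep s₀ s

  FiniteReachableMarkings : Set
  FiniteReachableMarkings =
    Σ (List Marking) λ ms → ∀ s → Reachable s → Any (λ m → ∀ p → State.mk s p ≡ m p) ms

  OneSafe : Set
  OneSafe = ∀ s → Reachable s → ∀ p → State.mk s p ≤ℕ 1

data Act (A : Set) : Set where
  vis   : A → Act A
  τ     : Act A
  delay : ℚ → Act A

module _ {A S : Set} (step : S → Act A → S → Set) where

  τ* : S → S → Set
  τ* = Star (λ a b → step a τ b)

  WeakStep : S → Act A → S → Set
  WeakStep s τ s' = τ* s s'
  WeakStep s (vis a) s' = ∃ λ s'' → τ* s s'' × step s'' (vis a) s'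
  WeakStep s (delay θ) s' = ∃ λ s'' → τ* s s'' × step s'' (delay θ) s'

WeakTimedSim : {A S₁ S₂ : Set} → (S₁ → Act A → S₁ → Set) → (S₂ → Act A → S₂ → Set) →
               (S₁ → S₂ → Set) → Set
WeakTimedSim step₁ step₂ R =
  ∀ s₁ s₂ α s₁' → R s₁ s₂ → step₁ s₁ α s₁' →
  ∃ λ s₂' → WeakStep step₂ s₂ α s₂' × R s₁' s₂'

NStep : (N : TPN) → State N → Act (Fin (TPN.nT N)) → State N → Set
NStep N s (vis t) s' = Fire N s t s'
NStep N s τ s' = ⊥
NStep N s (delay θ) s' = Delay N s θ s'

LStep : (N : TPN) (N× : TPN) (lab : Fin (TPN.nT N×) → Maybe (Fin (TPN.nT N))) →
        State N× → Act (Fin (TPN.nT N)) → State N× → Set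
LStep N N× lab s (vis a) s' = ∃ λ t → lab t ≡ just a × Fire N× s t s'
LStep N N× lab s τ s' = ∃ λ t → lab t ≡ nothing × Fire N× s t s'
LStep N N× lab s (delay θ) s' = Delay N× s θ s'

WeakTimedBisimilar : (N N× : TPN) (lab : Fin (TPN.nT N×) → Maybe (Fin (TPN.nT N))) → Set₁
WeakTimedBisimilar N N× lab =
  Σ (State N → State N× → Set) λ R →
    WeakTimedSim (NStep N) (LStep N N× lab) R ×
    WeakTimedSim (LStep N N× lab) (NStep N) (λ s₂ s₁ → R s₁ s₂) ×
    (∀ s₁ → Initial N s₁ → ∃ λ s₂ → Initial N× s₂ × R s₁ s₂) ×
    (∀ s₂ → Initial N× s₂ → ∃ λ s₁ → Initial N s₁ × R s₁ s₂)

module Submission where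

-- N× simulates N on an explicit list of its reachable markings.  Its places are control i
-- (N is in its i-th reachable marking) and, for every transition k of N, running k and
-- expired k (k is enabled and its clock has not yet / has already run out).  The silent
-- transition expire k, with static interval Is k, moves the token of running k to expired k;
-- the transition fire i t b, labelled t and with interval [0,0], moves control i to the
-- control place of the successor marking, removes the clock tokens of all transitions that t
-- disables or resets and puts fresh tokens on running k for the newly enabled k.  A reachable
-- marking of N× is therefore determined by i and the set e of expired clocks, and has at most
-- one token per place.  A state (m, φ) of N is related to the state of N× whose clock of
-- expire k is φ k and whose fire clocks are 0.  Firing t in N is matched by expire t (unless
-- already done) followed by fire i t b; conversely fire i t b can only occur once the clock of
-- t has expired, i.e. when φ t = 0.  Time elapses equally on both sides because an enabled
-- fire transition, like an expired clock of N, blocks time.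

open import Defs
open import Data.Bool using (Bool; true; false; T; not; _∧_; _∨_; if_then_else_)
import Data.Bool.Properties as BoolP
open import Data.Nat using (ℕ; _+_; _∸_; _*_; _^_; z≤n; s≤s) renaming (_≤_ to _≤ℕ_)
import Data.Nat.Properties as ℕP
open import Data.Empty using (⊥-elim)
open import Data.Unit using (tt)
open import Data.Fin using (Fin; _≟_; finToFun; funToFin)
import Data.Fin.Properties as FinP
open import Data.List using (List; length; lookup)
open import Data.List.Relation.Unary.Any as Any using (Any; any?)
open import Data.List.Relation.Unary.Any.Properties using (lookup-index)
open import Data.Rational using (ℚ; 0ℚ; _-_; -_) renaming (_≤_ to _≤ℚ_)
import Data.Rational.Properties as ℚP
open import Data.Maybe using (Maybe; just; nothing; maybe′)
open import Data.Product using (Σ; _×_; _,_; proj₁; proj₂; ∃; map₂)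
open import Data.Sum using (_⊎_; inj₁; inj₂; [_,_]′)
open import Function using (_∘_; flip; id)
open import Relation.Nullary using (¬_; Dec; yes; no; ¬?)
open import Relation.Nullary.Decidable using (T?; _×-dec_; ⌊_⌋; toWitness; fromWitness; isYes≗does; does-⇔; dec-false)
open import Function.Bundles using (_↔_; Inverse; _⇔_; mk⇔; Equivalence)
open import Function.Construct.Identity using (↔-id)
open import Function.Construct.Composition using (_↔-∘_)
open import Data.Sum.Function.Propositional using (_⊎-↔_)
open import Data.Product.Function.NonDependent.Propositional using (_×-↔_)
open import Relation.Binary.PropositionalEquality
open import Relation.Binary.Construct.Closure.ReflexiveTransitive using (Star; ε; _◅_; _◅◅_)

iverson : Bool → ℕ
iverson b = if b then 1 else 0

iverson≤1 : ∀ b → iverson b ≤ℕ 1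
iverson≤1 false = z≤n
iverson≤1 true = s≤s z≤n

iverson-mono : ∀ {a b} → (T a → T b) → iverson a ≤ℕ iverson b
iverson-mono {false} _ = z≤n
iverson-mono {true} {true} _ = s≤s z≤n
iverson-mono {true} {false} a⇒b = ⊥-elim (a⇒b tt)

iverson-mono⁻¹ : ∀ {a b} → iverson a ≤ℕ iverson b → T a → T b
iverson-mono⁻¹ {true} {true} _ _ = tt

-- Token balances on the clock places running k and expired k of N×: en and en' say whether k is
-- enabled before and after the step, ek whether its clock has expired, pers whether k persists,
-- bk is the bit of the fired transition for k, and isK, isT whether k is the expiring or fired one.
expire-running-balance : ∀ en ek isK → (T isK → T (en ∧ not ek)) →
                         iverson (en ∧ not ek) ∸ iverson isK + 0 ≡ iverson (en ∧ not (ek ∨ isK))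
expire-running-balance false ek false _ = refl
expire-running-balance true false false _ = refl
expire-running-balance true true false _ = refl
expire-running-balance true false true _ = refl
expire-running-balance true true true h = ⊥-elim (h tt)
expire-running-balance false ek true h = ⊥-elim (h tt)

expire-expired-balance : ∀ en ek isK → (T isK → T (en ∧ not ek)) →
                         iverson (en ∧ ek) ∸ 0 + iverson isK ≡ iverson (en ∧ (ek ∨ isK))
expire-expired-balance false ek false _ = refl
expire-expired-balance true false false _ = refl
expire-expired-balance true true false _ = refl
expire-expired-balance true false true _ = refl
expire-expired-balance true true true h = ⊥-elim (h tt)
expire-expired-balance false ek true h = ⊥-elim (h tt)

fire-running-balance : ∀ en pers ek bk en' → (T pers → T en) → (T pers → T en') → (T (en ∧ not pers) → bk ≡ ek) →
  iverson (en ∧ not ek) ∸ iverson ((en ∧ not pers) ∧ not bk) + iverson (en' ∧ not pers) ≡ iverson (en' ∧ not (pers ∧ ek))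
fire-running-balance false true _ _ _ pers⇒en _ _ = ⊥-elim (pers⇒en tt)
fire-running-balance true true _ _ false _ pers⇒en' _ = ⊥-elim (pers⇒en' tt)
fire-running-balance true true false _ true _ _ _ = refl
fire-running-balance true true true _ true _ _ _ = refl
fire-running-balance false false _ _ _ _ _ _ = refl
fire-running-balance true false ek bk en' _ _ bk≡ek with bk≡ek tt
fire-running-balance true false false .false en' _ _ _ | refl = refl
fire-running-balance true false true .true en' _ _ _ | refl = refl

fire-expired-balance : ∀ en pers ek bk en' isT → (T pers → T en) → (T pers → T en') → (T pers → ¬ T isT) →
  (T (en ∧ not pers) → bk ≡ ek) →
  iverson (en ∧ ek) ∸ iverson (isT ∨ (en ∧ not pers) ∧ bk) + 0 ≡ iverson (en' ∧ (pers ∧ ek))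
fire-expired-balance false true _ _ _ _ pers⇒en _ _ _ = ⊥-elim (pers⇒en tt)
fire-expired-balance true true _ _ false _ _ pers⇒en' _ _ = ⊥-elim (pers⇒en' tt)
fire-expired-balance true true _ _ true true _ _ pers⇒¬isT _ = ⊥-elim (pers⇒¬isT tt tt)
fire-expired-balance true true false _ true false _ _ _ _ = refl
fire-expired-balance true true true _ true false _ _ _ _ = refl
fire-expired-balance en false ek bk en' isT _ _ _ bk≡ek =
  trans (cleared en ek bk isT bk≡ek) (cong iverson (sym (BoolP.∧-zeroʳ en')))
  where
  cleared : ∀ en ek bk isT → (T (en ∧ true) → bk ≡ ek) → iverson (en ∧ ek) ∸ iverson (isT ∨ (en ∧ true) ∧ bk) + 0 ≡ 0
  cleared false _ _ false _ = refl
  cleared false _ _ true _ = refl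
  cleared true ek bk isT bk≡ek with bk≡ek tt
  cleared true false .false false _ | refl = refl
  cleared true false .false true _ | refl = refl
  cleared true true .true false _ | refl = refl
  cleared true true .true true _ | refl = refl

discarded-running : ∀ en pers bk ek → (T (en ∧ not pers) → bk ≡ ek) → T ((en ∧ not pers) ∧ not bk) → T (en ∧ not ek)
discarded-running true false bk ek bk≡ek h = subst (T ∘ not) (bk≡ek tt) h

discarded-expired : ∀ en pers bk ek → (T (en ∧ not pers) → bk ≡ ek) → T ((en ∧ not pers) ∧ bk) → T (en ∧ ek)
discarded-expired true false bk ek bk≡ek h = subst T (bk≡ek tt) h

matching-bit : ∀ d bk en ek → T d → (T (d ∧ not bk) → T (en ∧ not ek)) → (T (d ∧ bk) → T (en ∧ ek)) → bk ≡ ek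
matching-bit true false en false _ _ _ = refl
matching-bit true true en true _ _ _ = refl
matching-bit true false false true _ h _ = ⊥-elim (h tt)
matching-bit true false true true _ h _ = ⊥-elim (h tt)
matching-bit true true false false _ _ h = ⊥-elim (h tt)
matching-bit true true true false _ _ h = ⊥-elim (h tt)

fire-keeps-running⇔ : ∀ en pers ek bk → T (en ∧ not ek) → (T (en ∧ not pers) → bk ≡ ek) →
                      1 ≤ℕ iverson (en ∧ not ek) ∸ iverson ((en ∧ not pers) ∧ not bk) ⇔ T pers
fire-keeps-running⇔ true true false bk _ _ = mk⇔ (λ _ → tt) (λ _ → s≤s z≤n)
fire-keeps-running⇔ true false false bk _ bk≡ek with bk≡ek tt
... | refl = mk⇔ (λ ()) (λ ())

not-ticking : ∀ en ek → T en → ¬ T (en ∧ not ek) → T ek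
not-ticking true true _ _ = tt
not-ticking true false _ ticking = ⊥-elim (ticking tt)

ticking-expireAt : ∀ en ek isK → T (en ∧ not (ek ∨ isK)) → ¬ T isK × T (en ∧ not ek)
ticking-expireAt true false false _ = (λ ()) , tt

ticking-intro : ∀ en ek → T en → ¬ T ek → T (en ∧ not ek)
ticking-intro true true _ ¬ek = ⊥-elim (¬ek tt)
ticking-intro true false _ _ = tt

inherited-ticking : ∀ en en' pers ek → T pers → T en → T (en' ∧ not (pers ∧ ek)) → T (en ∧ not ek)
inherited-ticking true true true false _ _ _ = tt

inherited-ticking-intro : ∀ en' pers ek → T en' → (T pers → ¬ T ek) → T (en' ∧ not (pers ∧ ek))
inherited-ticking-intro true false ek _ _ = tt
inherited-ticking-intro true true false _ _ = tt
inherited-ticking-intro true true true _ ¬ek = ⊥-elim (¬ek tt tt)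

inherited-expired : ∀ en' pers ek → T pers → T ek → ¬ T (en' ∧ not (pers ∧ ek))
inherited-expired false _ _ _ _ ()
inherited-expired true true true _ _ ()

module _ (M : TPN) where
  open TPN M
  open State

  enabled? : ∀ m k → Dec (Enabled M m k)
  enabled? m k = FinP.all? λ p → Pre k p ℕP.≤? m p

  persistent? : ∀ m t k → Dec (Persistent M m t k)
  persistent? m t k =
    ¬? (k ≟ t) ×-dec enabled? m k ×-dec FinP.all? λ p → Pre k p ℕP.≤? (m p ∸ Pre t p)

  Enabled-resp-≗ : ∀ {m m' k} → m ≗ m' → Enabled M m k → Enabled M m' k
  Enabled-resp-≗ {k = k} m≗m' en p = subst (Pre k p ≤ℕ_) (m≗m' p) (en p)

  Persistent-resp-≗ : ∀ {m m' t k} → m ≗ m' → Persistent M m t k → Persistent M m' t k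
  Persistent-resp-≗ {t = t} {k} m≗m' (k≢t , en , left) =
    k≢t , Enabled-resp-≗ m≗m' en , λ p → subst (λ n → Pre k p ≤ℕ n ∸ Pre t p) (m≗m' p) (left p)

  Persistent⇒Enabled-after : ∀ {m t k} → Persistent M m t k → Enabled M (λ p → m p ∸ Pre t p + Post t p) k
  Persistent⇒Enabled-after {m} {t} (_ , _ , left) p = ℕP.≤-trans (left p) (ℕP.m≤m+n (m p ∸ Pre t p) (Post t p))

  Reachable-step : ∀ {s s'} → Reachable M s → AnyStep M s s' → Reachable M s'
  Reachable-step (s₀ , init , path) step = s₀ , init , path ◅◅ (step ◅ ε)

  Delay-enabled-zero : ∀ {s θ s' k} → Delay M s θ s' → Enabled M (mk s) k → φ s k ≡ 0ℚ → θ ≡ 0ℚ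
  Delay-enabled-zero (0≤θ , θ≤φ , _) en φ≡0 = ℚP.≤-antisym (subst (_ ≤ℚ_) φ≡0 (θ≤φ _ en)) 0≤θ

  onEnabled : ∀ {m k} → Dec (Enabled M m k) → ℚ → ℚ
  onEnabled (yes _) q = q
  onEnabled (no _) _ = 0ℚ

  onEnabled-yes : ∀ {m k q} (d : Dec (Enabled M m k)) → Enabled M m k → onEnabled d q ≡ q
  onEnabled-yes (yes _) _ = refl
  onEnabled-yes (no dis) en = ⊥-elim (dis en)

  restrict : (m : Marking M) (f : Fin nT → ℚ) → (∀ k → Enabled M m k → 0ℚ ≤ℚ f k) → State M
  restrict m f f≥0 = record
    { mk = m ; φ = λ k → onEnabled (enabled? m k) (f k)
    ; φ-nonneg = λ k → nonneg (enabled? m k)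
    ; φ-dis = λ k dis → disabled (enabled? m k) dis }
    where
    nonneg : ∀ {k} (d : Dec (Enabled M m k)) → 0ℚ ≤ℚ onEnabled d (f k)
    nonneg {k} (yes en) = f≥0 k en
    nonneg (no _) = ℚP.≤-refl
    disabled : ∀ {k} (d : Dec (Enabled M m k)) → ¬ Enabled M m k → onEnabled d (f k) ≡ 0ℚ
    disabled (yes en) dis = ⊥-elim (dis en)
    disabled (no _) _ = refl

  restrict-enabled : ∀ {m f f≥0 k} → Enabled M m k → φ (restrict m f f≥0) k ≡ f k
  restrict-enabled {m} {k = k} = onEnabled-yes (enabled? m k)

  Delay-exists : ∀ {s θ} → 0ℚ ≤ℚ θ → (∀ k → Enabled M (mk s) k → θ ≤ℚ φ s k) → ∃ λ s' → Delay M s θ s'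
  Delay-exists {s} {θ} 0≤θ θ≤φ =
    restrict (mk s) (λ k → φ s k - θ) nonneg , 0≤θ , θ≤φ , (λ _ → refl) , λ _ → restrict-enabled {f≥0 = nonneg}
    where
    nonneg : ∀ k → Enabled M (mk s) k → 0ℚ ≤ℚ φ s k - θ
    nonneg k en = subst (_≤ℚ φ s k - θ) (ℚP.+-inverseʳ θ) (ℚP.+-monoˡ-≤ (- θ) (θ≤φ k en))

  Fire-exists : ∀ {s t} → Enabled M (mk s) t → φ s t ≡ 0ℚ → ∃ λ s' → Fire M s t s'
  Fire-exists {s} {t} en φt≡0 = restrict after inherited nonneg , en , φt≡0 , (λ _ → refl) , clocks
    where
    after : Marking M
    after p = mk s p ∸ Pre t p + Post t p
    inherit : ∀ {k} → Dec (Persistent M (mk s) t k) → ℚ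
    inherit {k} (yes _) = φ s k
    inherit {k} (no _) = Interval.lo (Is k)
    inherited : Fin nT → ℚ
    inherited k = inherit (persistent? (mk s) t k)
    nonneg : ∀ k → Enabled M after k → 0ℚ ≤ℚ inherited k
    nonneg k _ with persistent? (mk s) t k
    ... | yes _ = φ-nonneg s k
    ... | no _ = Interval.lo-nonneg (Is k)
    inherit-spec : ∀ {k} (d : Dec (Persistent M (mk s) t k)) →
                   (Persistent M (mk s) t k → inherit d ≡ φ s k) × (¬ Persistent M (mk s) t k → inherit d ∈I Is k)
    inherit-spec (yes p) = (λ _ → refl) , λ np → ⊥-elim (np p)
    inherit-spec {k} (no np) = (λ p → ⊥-elim (np p)) , λ _ → ℚP.≤-refl , Interval.lo≤hi (Is k)
    clocks : ∀ k → Enabled M after k →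
             (Persistent M (mk s) t k → φ (restrict after inherited nonneg) k ≡ φ s k) ×
             (¬ Persistent M (mk s) t k → φ (restrict after inherited nonneg) k ∈I Is k)
    clocks k en' rewrite restrict-enabled {f = inherited} {f≥0 = nonneg} en' = inherit-spec (persistent? (mk s) t k)

  Fire-keeps-zero-clock : ∀ {s t s' k} → Fire M s t s' → Enabled M (mk s') k →
                          (∀ q → q ∈I Is k → q ≡ 0ℚ) → φ s k ≡ 0ℚ → φ s' k ≡ 0ℚ
  Fire-keeps-zero-clock {s} {t} {k = k} (_ , _ , _ , clocks) en only-zero φ≡0 with persistent? (mk s) t k
  ... | yes p = trans (proj₁ (clocks k en) p) φ≡0
  ... | no np = only-zero _ (proj₂ (clocks k en) np)

module _ {N N× : TPN} {lab : Fin (TPN.nT N×) → Maybe (Fin (TPN.nT N))} where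

  AnyStep⇒LStep : ∀ {x x'} → AnyStep N× x x' → ∃ λ α → LStep N N× lab x α x'
  AnyStep⇒LStep (inj₁ (y , firing)) with lab y in eq
  ... | just a = vis a , y , eq , firing
  ... | nothing = τ , y , eq , firing
  AnyStep⇒LStep (inj₂ (θ , d)) = delay θ , d

  Reachable-related : {R : State N → State N× → Set} → WeakTimedSim (LStep N N× lab) (NStep N) (flip R) →
                      (∀ x → Initial N× x → ∃ λ s → R s x) → ∀ x → Reachable N× x → ∃ λ s → R s x
  Reachable-related {R} sim init x (x₀ , x₀-init , path) = walk (proj₂ (init x₀ x₀-init)) path
    where
    walk : ∀ {s x x'} → R s x → Star (AnyStep N×) x x' → ∃ λ s' → R s' x'
    walk r ε = _ , r
    walk {s} {x} r (step ◅ steps) with AnyStep⇒LStep step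
    ... | α , lstep = walk (proj₂ (proj₂ (sim x s α _ r lstep))) steps

-- The net N×

bits : ∀ {n} → Fin (2 ^ n) → Fin n → Bool
bits b k = Inverse.to FinP.2↔Bool (finToFun b k)

fromBits : ∀ {n} → (Fin n → Bool) → Fin (2 ^ n)
fromBits e = funToFin (Inverse.from FinP.2↔Bool ∘ e)

bits-fromBits : ∀ {n} (e : Fin n → Bool) k → bits (fromBits e) k ≡ e k
bits-fromBits e k =
  trans (cong (Inverse.to FinP.2↔Bool) (FinP.finToFun-funToFin _ k)) (Inverse.strictlyInverseˡ FinP.2↔Bool (e k))

module Construction (N : TPN) (finite : FiniteReachableMarkings N) where
  open TPN N
  open State

  markings : List (Marking N)
  markings = proj₁ finite

  L : ℕ
  L = length markings

  marking : Fin L → Marking N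
  marking = lookup markings

  after : Fin L → Fin nT → Marking N
  after i t p = marking i p ∸ Pre t p + Post t p

  firstIndex : ∀ {P : Marking N → Set} → Dec (Any P markings) → Maybe (Fin L)
  firstIndex (yes found) = just (Any.index found)
  firstIndex (no _) = nothing

  firstIndex-sound : ∀ {P j} (d : Dec (Any P markings)) → firstIndex d ≡ just j → P (marking j)
  firstIndex-sound (yes found) refl = lookup-index found

  firstIndex-complete : ∀ {P} (d : Dec (Any P markings)) → Any P markings → ∃ λ j → firstIndex d ≡ just j
  firstIndex-complete (yes found) _ = Any.index found , refl
  firstIndex-complete (no none) found = ⊥-elim (none found)

  target : Fin L → Fin nT → Maybe (Fin L)
  target i t = firstIndex (any? (λ m → FinP.all? λ p → after i t p ℕP.≟ m p) markings)

  target-sound : ∀ {i t j} → target i t ≡ just j → after i t ≗ marking j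
  target-sound = firstIndex-sound (any? _ markings)

  target-complete : ∀ {i t} → Any (after i t ≗_) markings → ∃ λ j → target i t ≡ just j
  target-complete = firstIndex-complete (any? _ markings)

  Place : Set
  Place = Fin L ⊎ Fin nT ⊎ Fin nT

  pattern control i = inj₁ i
  pattern running k = inj₂ (inj₁ k)
  pattern expired k = inj₂ (inj₂ k)

  Trans : Set
  Trans = Fin nT ⊎ Fin L × Fin nT × Fin (2 ^ nT)

  -- bits b k says whether fire i t b expects the clock of k, if t discards it, in expired k
  -- rather than in running k.
  pattern expire k = inj₁ k
  pattern fire i t b = inj₂ (i , t , b)

  placeEnum : Fin (L + (nT + nT)) ↔ Place
  placeEnum = (↔-id (Fin L) ⊎-↔ FinP.+↔⊎) ↔-∘ FinP.+↔⊎

  transEnum : Fin (nT + L * (nT * 2 ^ nT)) ↔ Trans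
  transEnum = (↔-id (Fin nT) ⊎-↔ ((↔-id (Fin L) ×-↔ FinP.*↔×) ↔-∘ FinP.*↔×)) ↔-∘ FinP.+↔⊎

  opaque
    placeOf : Fin (L + (nT + nT)) → Place
    placeOf = Inverse.to placeEnum

    placeAt : Place → Fin (L + (nT + nT))
    placeAt = Inverse.from placeEnum

    placeOf-placeAt : ∀ q → placeOf (placeAt q) ≡ q
    placeOf-placeAt = Inverse.strictlyInverseˡ placeEnum

    transOf : Fin (nT + L * (nT * 2 ^ nT)) → Trans
    transOf = Inverse.to transEnum

    transAt : Trans → Fin (nT + L * (nT * 2 ^ nT))
    transAt = Inverse.from transEnum

    transOf-transAt : ∀ a → transOf (transAt a) ≡ a
    transOf-transAt = Inverse.strictlyInverseˡ transEnum

    transAt-transOf : ∀ y → transAt (transOf y) ≡ y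
    transAt-transOf = Inverse.strictlyInverseʳ transEnum

  enabledᵇ : Marking N → Fin nT → Bool
  enabledᵇ m k = ⌊ enabled? N m k ⌋

  persistsᵇ : Fin L → Fin nT → Fin nT → Bool
  persistsᵇ i t k = ⌊ persistent? N (marking i) t k ⌋

  discarded : Fin L → Fin nT → Fin nT → Bool
  discarded i t k = enabledᵇ (marking i) k ∧ not (persistsᵇ i t k)

  newlyEnabled : Fin L → Fin nT → Fin nT → Bool
  newlyEnabled i t k = enabledᵇ (after i t) k ∧ not (persistsᵇ i t k)

  isTarget : Fin L → Fin nT → Fin L → Bool
  isTarget i t j = maybe′ (λ j' → ⌊ j ≟ j' ⌋) false (target i t)

  pre : Trans → Place → ℕ
  pre (expire k) (running k') = iverson ⌊ k' ≟ k ⌋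
  pre (expire k) _ = 0
  pre (fire i t b) (control i') = iverson ⌊ i' ≟ i ⌋
  pre (fire i t b) (running k) = iverson (discarded i t k ∧ not (bits b k))
  pre (fire i t b) (expired k) = iverson (⌊ k ≟ t ⌋ ∨ discarded i t k ∧ bits b k)

  post : Trans → Place → ℕ
  post (expire k) (expired k') = iverson ⌊ k' ≟ k ⌋
  post (expire k) _ = 0
  post (fire i t b) (control j) = iverson (isTarget i t j)
  post (fire i t b) (running k) = iverson (newlyEnabled i t k)
  post (fire i t b) (expired k) = 0

  -- e k records whether the clock of k has expired.
  shape : Fin L → (Fin nT → Bool) → Place → ℕ
  shape i e (control i') = iverson ⌊ i' ≟ i ⌋
  shape i e (running k) = iverson (enabledᵇ (marking i) k ∧ not (e k))
  shape i e (expired k) = iverson (enabledᵇ (marking i) k ∧ e k)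

  zeroInterval : Interval
  zeroInterval = record { lo = 0ℚ ; hi = just 0ℚ ; lo-nonneg = ℚP.≤-refl ; lo≤hi = λ { _ refl → ℚP.≤-refl } }

  interval : Trans → Interval
  interval (expire k) = Is k
  interval (fire _ _ _) = zeroInterval

  label : Trans → Maybe (Fin nT)
  label (expire _) = nothing
  label (fire _ t _) = just t

  initialState : State N
  initialState = restrict N m₀ (Interval.lo ∘ Is) λ k _ → Interval.lo-nonneg (Is k)

  initialState-Initial : Initial N initialState
  initialState-Initial = (λ _ → refl) , λ k en →
    subst (_∈I Is k) (sym (restrict-enabled N {f = Interval.lo ∘ Is} {f≥0 = λ k _ → Interval.lo-nonneg (Is k)} en))
      (ℚP.≤-refl , Interval.lo≤hi (Is k))

  i₀ : Fin L
  i₀ = Any.index (proj₂ finite initialState (initialState , initialState-Initial , ε))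

  m₀≗marking-i₀ : m₀ ≗ marking i₀
  m₀≗marking-i₀ = lookup-index (proj₂ finite initialState (initialState , initialState-Initial , ε))

  noneExpired : Fin nT → Bool
  noneExpired _ = false

  N× : TPN
  N× = record
    { nP = L + (nT + nT)
    ; nT = nT + L * (nT * 2 ^ nT)
    ; Pre = λ y p → pre (transOf y) (placeOf p)
    ; Post = λ y p → post (transOf y) (placeOf p)
    ; m₀ = shape i₀ noneExpired ∘ placeOf
    ; Is = interval ∘ transOf
    }

  lab : Fin (TPN.nT N×) → Maybe (Fin nT)
  lab = label ∘ transOf

  record Shaped (m : Marking N×) (μ : Place → ℕ) : Set where
    constructor tokens
    field tokens≡ : ∀ p → m p ≡ μ (placeOf p)
  open Shaped

  EnabledAt : (Place → ℕ) → Trans → Set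
  EnabledAt μ a = ∀ q → pre a q ≤ℕ μ q

  ∀-Shaped⇔ : ∀ {m μ} → Shaped m μ → (R : ℕ → Place → Set) → (∀ p → R (m p) (placeOf p)) ⇔ (∀ q → R (μ q) q)
  ∀-Shaped⇔ {m} {μ} (tokens shaped) R = mk⇔
    (λ h q → subst (λ q → R (μ q) q) (placeOf-placeAt q) (subst (λ n → R n _) (shaped (placeAt q)) (h (placeAt q))))
    (λ h p → subst (λ n → R n (placeOf p)) (sym (shaped p)) (h (placeOf p)))

  Enabled×⇔ : ∀ {m μ y} → Shaped m μ → Enabled N× m y ⇔ EnabledAt μ (transOf y)
  Enabled×⇔ {y = y} shaped = ∀-Shaped⇔ shaped (λ n q → pre (transOf y) q ≤ℕ n)

  Step×⇔ : ∀ {m m' y μ μ'} → Shaped m μ → (∀ q → μ' q ≡ μ q ∸ pre (transOf y) q + post (transOf y) q) →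
           (∀ p → m' p ≡ m p ∸ TPN.Pre N× y p + TPN.Post N× y p) ⇔ Shaped m' μ'
  Step×⇔ {y = y} (tokens shaped) balance = mk⇔
    (λ step → tokens λ p → trans (step p) (trans (cong (fires p) (shaped p)) (sym (balance (placeOf p)))))
    (λ (tokens shaped') p → trans (shaped' p) (trans (balance (placeOf p)) (cong (fires p) (sym (shaped p)))))
    where
    fires : Fin (L + (nT + nT)) → ℕ → ℕ
    fires p n = n ∸ pre (transOf y) (placeOf p) + post (transOf y) (placeOf p)

  Persistent×-expire⇔ : ∀ {m μ y y' k} → Shaped m μ → transOf y' ≡ expire k → transOf y ≢ expire k →
                        Persistent N× m y y' ⇔ 1 ≤ℕ μ (running k) ∸ pre (transOf y) (running k)
  Persistent×-expire⇔ {m} {μ} {y} {y'} {k} shaped y'↦k y↦̸k = mk⇔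
    (λ (_ , _ , stays) → ℕP.≤-trans (iverson-mono (λ _ → fromWitness refl))
       (subst (λ a → pre a (running k) ≤ℕ _) y'↦k (Equivalence.to (∀-Shaped⇔ shaped R) stays (running k))))
    λ h → (λ y'≡y → y↦̸k (trans (cong transOf (sym y'≡y)) y'↦k)) ,
          Equivalence.from (Enabled×⇔ shaped)
            (subst (EnabledAt μ) (sym y'↦k) (expire-below (ℕP.≤-trans h (ℕP.m∸n≤m _ (pre (transOf y) (running k)))))) ,
          Equivalence.from (∀-Shaped⇔ shaped R) (subst (λ a → ∀ q → pre a q ≤ℕ _) (sym y'↦k) (expire-below h))
    where
    R : ℕ → Place → Set
    R n q = pre (transOf y') q ≤ℕ n ∸ pre (transOf y) q
    expire-below : ∀ {ν : Place → ℕ} → 1 ≤ℕ ν (running k) → ∀ q → pre (expire k) q ≤ℕ ν q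
    expire-below h (control _) = z≤n
    expire-below h (expired _) = z≤n
    expire-below {ν} h (running k') with k' ≟ k
    ... | yes refl = h
    ... | no _ = z≤n

  Ticking : Fin L → (Fin nT → Bool) → Fin nT → Set
  Ticking i e k = T (enabledᵇ (marking i) k ∧ not (e k))

  ticking-at : ∀ {i e k k'} → Ticking i e k → T ⌊ k' ≟ k ⌋ → Ticking i e k'
  ticking-at {i} {e} ticking k'≡k = subst (Ticking i e) (sym (toWitness k'≡k)) ticking

  FireReady : Fin L → (Fin nT → Bool) → Fin nT → Fin (2 ^ nT) → Set
  FireReady i e t b = T (enabledᵇ (marking i) t ∧ e t) × (∀ k → T (discarded i t k) → bits b k ≡ e k)

  expire-enabled⇔ : ∀ {i e k} → EnabledAt (shape i e) (expire k) ⇔ Ticking i e k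
  expire-enabled⇔ {i} {e} {k} = mk⇔
    (λ en → iverson-mono⁻¹ (en (running k)) (fromWitness refl))
    λ ticking → λ where
      (control _) → z≤n
      (expired _) → z≤n
      (running k') → iverson-mono (ticking-at ticking)

  fire-enabled⇔ : ∀ {i e i' t b} → EnabledAt (shape i e) (fire i' t b) ⇔ (i' ≡ i × FireReady i e t b)
  fire-enabled⇔ {i} {e} {i'} {t} {b} = mk⇔ to from
    where
    to : EnabledAt (shape i e) (fire i' t b) → i' ≡ i × FireReady i e t b
    to en with toWitness (iverson-mono⁻¹ (en (control i')) (fromWitness refl))
    ... | refl = refl ,
      iverson-mono⁻¹ (en (expired t)) (Equivalence.from (BoolP.T-∨ {⌊ t ≟ t ⌋}) (inj₁ (fromWitness refl))) ,
      λ k d → matching-bit (discarded i t k) (bits b k) _ _ d (iverson-mono⁻¹ (en (running k)))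
                (λ h → iverson-mono⁻¹ (en (expired k)) (Equivalence.from (BoolP.T-∨ {⌊ k ≟ t ⌋}) (inj₂ h)))
    from : i' ≡ i × FireReady i e t b → EnabledAt (shape i e) (fire i' t b)
    from (refl , t-ready , bits≡) (control _) = ℕP.≤-refl
    from (refl , t-ready , bits≡) (running k) =
      iverson-mono (discarded-running (enabledᵇ (marking i) k) (persistsᵇ i t k) (bits b k) (e k) (bits≡ k))
    from (refl , t-ready , bits≡) (expired k) = iverson-mono λ h →
      [ (λ k≡t → subst (λ k → T (enabledᵇ (marking i) k ∧ e k)) (sym (toWitness k≡t)) t-ready)
      , discarded-expired (enabledᵇ (marking i) k) (persistsᵇ i t k) (bits b k) (e k) (bits≡ k)
      ]′ (Equivalence.to (BoolP.T-∨ {⌊ k ≟ t ⌋}) h)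

  enabledᵇ-resp-≗ : ∀ {m m' k} → m ≗ m' → enabledᵇ m k ≡ enabledᵇ m' k
  enabledᵇ-resp-≗ {m} {m'} {k} m≗m' =
    trans (isYes≗does (enabled? N m k))
      (trans (does-⇔ (mk⇔ (Enabled-resp-≗ N m≗m') (Enabled-resp-≗ N (sym ∘ m≗m'))) (enabled? N m k) (enabled? N m' k))
        (sym (isYes≗does (enabled? N m' k))))

  persists⇒enabled : ∀ {i t k} → T (persistsᵇ i t k) → T (enabledᵇ (marking i) k)
  persists⇒enabled p = fromWitness (proj₁ (proj₂ (toWitness p)))

  persists⇒enabled-after : ∀ {i t k} → T (persistsᵇ i t k) → T (enabledᵇ (after i t) k)
  persists⇒enabled-after p = fromWitness (Persistent⇒Enabled-after N (toWitness p))

  persists⇒≢ : ∀ {i t k} → T (persistsᵇ i t k) → ¬ T ⌊ k ≟ t ⌋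
  persists⇒≢ p k≡t = proj₁ (toWitness p) (toWitness k≡t)

  expireAt : (Fin nT → Bool) → Fin nT → Fin nT → Bool
  expireAt e k k' = e k' ∨ ⌊ k' ≟ k ⌋

  inheritedExpiry : Fin L → Fin nT → (Fin nT → Bool) → Fin nT → Bool
  inheritedExpiry i t e k = persistsᵇ i t k ∧ e k

  expire-balance : ∀ {i e k} → Ticking i e k →
                   ∀ q → shape i (expireAt e k) q ≡ shape i e q ∸ pre (expire k) q + post (expire k) q
  expire-balance _ (control _) = sym (ℕP.+-identityʳ _)
  expire-balance {i} {e} {k} ticking (running k') =
    sym (expire-running-balance (enabledᵇ (marking i) k') (e k') ⌊ k' ≟ k ⌋ (ticking-at ticking))
  expire-balance {i} {e} {k} ticking (expired k') =
    sym (expire-expired-balance (enabledᵇ (marking i) k') (e k') ⌊ k' ≟ k ⌋ (ticking-at ticking))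

  fire-balance : ∀ {i e t b j} → target i t ≡ just j → FireReady i e t b →
                 ∀ q → shape j (inheritedExpiry i t e) q ≡ shape i e q ∸ pre (fire i t b) q + post (fire i t b) q
  fire-balance {i} tgt _ (control i') rewrite tgt | ℕP.n∸n≡0 (iverson ⌊ i' ≟ i ⌋) = refl
  fire-balance {i} {e} {t} {b} tgt (_ , bits≡) (running k) =
    trans (cong (λ en → iverson (en ∧ not (persistsᵇ i t k ∧ e k))) (sym (enabledᵇ-resp-≗ (target-sound tgt))))
      (sym (fire-running-balance (enabledᵇ (marking i) k) (persistsᵇ i t k) (e k) (bits b k) (enabledᵇ (after i t) k)
              persists⇒enabled persists⇒enabled-after (bits≡ k)))
  fire-balance {i} {e} {t} {b} tgt (_ , bits≡) (expired k) =
    trans (cong (λ en → iverson (en ∧ (persistsᵇ i t k ∧ e k))) (sym (enabledᵇ-resp-≗ (target-sound tgt))))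
      (sym (fire-expired-balance (enabledᵇ (marking i) k) (persistsᵇ i t k) (e k) (bits b k) (enabledᵇ (after i t) k) ⌊ k ≟ t ⌋
              persists⇒enabled persists⇒enabled-after persists⇒≢ (bits≡ k)))

  expire-keeps : ∀ {i e k k'} → k' ≢ k → Ticking i e k' → 1 ≤ℕ shape i e (running k') ∸ pre (expire k) (running k')
  expire-keeps {i} {e} {k} {k'} k'≢k ticking =
    subst (λ n → 1 ≤ℕ shape i e (running k') ∸ iverson n) (sym (trans (isYes≗does (k' ≟ k)) (dec-false (k' ≟ k) k'≢k)))
      (iverson-mono λ _ → ticking)

  fire-keeps⇔ : ∀ {i e t b k} → Ticking i e k → (∀ k → T (discarded i t k) → bits b k ≡ e k) →
                1 ≤ℕ shape i e (running k) ∸ pre (fire i t b) (running k) ⇔ T (persistsᵇ i t k)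
  fire-keeps⇔ {i} {e} {t} {b} {k} ticking bits≡ =
    fire-keeps-running⇔ (enabledᵇ (marking i) k) (persistsᵇ i t k) (e k) (bits b k) ticking (bits≡ k)

  -- The bisimulation

  -- Expired clocks of N read 0 (expired-zero below), so expire k may carry the clock φ k throughout.
  clock : State N → Trans → ℚ
  clock s (expire k) = φ s k
  clock s (fire _ _ _) = 0ℚ

  clock-nonneg : ∀ s a → 0ℚ ≤ℚ clock s a
  clock-nonneg s (expire k) = φ-nonneg s k
  clock-nonneg s (fire _ _ _) = ℚP.≤-refl

  record Coherent (s : State N) (i : Fin L) (e : Fin nT → Bool) : Set where
    field
      marking≗ : mk s ≗ marking i
      expired-zero : ∀ k → T (e k) → φ s k ≡ 0ℚ
  open Coherent

  clock-disabled : ∀ {s i e} → Coherent s i e → ∀ a → ¬ EnabledAt (shape i e) a → clock s a ≡ 0ℚ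
  clock-disabled {s} {i} {e} coh (expire k) dis with enabled? N (mk s) k
  ... | no ¬en = φ-dis s k ¬en
  ... | yes en = expired-zero coh k (not-ticking _ (e k) (fromWitness (Enabled-resp-≗ N (marking≗ coh) en))
                                                   (dis ∘ Equivalence.from expire-enabled⇔))
  clock-disabled coh (fire _ _ _) _ = refl

  image : (s : State N) (i : Fin L) (e : Fin nT → Bool) → Coherent s i e → State N×
  image s i e coh = record
    { mk = shape i e ∘ placeOf
    ; φ = clock s ∘ transOf
    ; φ-nonneg = clock-nonneg s ∘ transOf
    ; φ-dis = λ y dis →
        clock-disabled coh (transOf y) (dis ∘ Equivalence.from (Enabled×⇔ {shape i e ∘ placeOf} (tokens λ _ → refl)))
    }

  readClocks : State N× → Marking N → State N
  readClocks x m = restrict N m (λ k → φ x (transAt (expire k))) (λ k _ → φ-nonneg x (transAt (expire k)))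

  readClocks-enabled : ∀ {x m k} → Enabled N m k → φ (readClocks x m) k ≡ φ x (transAt (expire k))
  readClocks-enabled {x} =
    restrict-enabled N {f = λ k → φ x (transAt (expire k))} {f≥0 = λ k _ → φ-nonneg x (transAt (expire k))}

  record Related (s : State N) (x : State N×) : Set where
    field
      index : Fin L
      expiry : Fin nT → Bool
      reachable : Reachable N s
      coherent : Coherent s index expiry
      shaped : Shaped (mk x) (shape index expiry)
      clocks : ∀ y → φ x y ≡ clock s (transOf y)
  open Related

  clocks-from-enabled : ∀ {s} {x : State N×} {i e} → Coherent s i e → Shaped (mk x) (shape i e) →
                        (∀ y → Enabled N× (mk x) y → φ x y ≡ clock s (transOf y)) → ∀ y → φ x y ≡ clock s (transOf y)
  clocks-from-enabled {x = x} coh sh enabled-clocks y with enabled? N× (mk x) y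
  ... | yes en = enabled-clocks y en
  ... | no dis = trans (φ-dis x y dis) (sym (clock-disabled coh (transOf y) (dis ∘ Equivalence.from (Enabled×⇔ sh))))

  image-Related : ∀ {s i e} → Reachable N s → (coh : Coherent s i e) → Related s (image s i e coh)
  image-Related {i = i} {e} reach coh = record
    { index = i ; expiry = e ; reachable = reach ; coherent = coh ; shaped = tokens (λ _ → refl) ; clocks = λ _ → refl }

  -- Goes through Fire-exists because, when N× fires, the matching successor state of N is built
  -- only from the target marking found here.
  successor-index : ∀ {s i t} → Reachable N s → mk s ≗ marking i → Enabled N (mk s) t → φ s t ≡ 0ℚ →
                    ∃ λ j → target i t ≡ just j
  successor-index {s} {i} {t} reach s≗i en φt≡0 with Fire-exists N {s} en φt≡0
  ... | s' , firing@(_ , _ , s'≗after , _) =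
    target-complete (Any.map (λ s'≗m p → trans (after≗s' p) (s'≗m p))
                             (proj₂ finite s' (Reachable-step N reach (inj₁ (t , firing)))))
    where
    after≗s' : after i t ≗ mk s'
    after≗s' p = trans (cong (λ n → n ∸ Pre t p + Post t p) (sym (s≗i p))) (sym (s'≗after p))

  ∈zeroInterval : ∀ {q} → q ∈I zeroInterval → q ≡ 0ℚ
  ∈zeroInterval (0≤q , q≤0) = ℚP.≤-antisym (q≤0 0ℚ refl) 0≤q

  0∈zeroInterval : 0ℚ ∈I zeroInterval
  0∈zeroInterval = ℚP.≤-refl , λ { _ refl → ℚP.≤-refl }

  Ticking⇒Enabled : ∀ {m i e k} → m ≗ marking i → Ticking i e k → Enabled N m k
  Ticking⇒Enabled {i = i} {k = k} m≗i ticking =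
    Enabled-resp-≗ N (sym ∘ m≗i) (toWitness (proj₁ (Equivalence.to (BoolP.T-∧ {enabledᵇ (marking i) k}) ticking)))

  Enabled-expire⇔ : ∀ {m i e y k} → Shaped m (shape i e) → transOf y ≡ expire k → Enabled N× m y ⇔ Ticking i e k
  Enabled-expire⇔ {i = i} {e} sh y↦k = mk⇔
    (λ en → Equivalence.to expire-enabled⇔ (subst (EnabledAt (shape i e)) y↦k (Equivalence.to (Enabled×⇔ sh) en)))
    (λ ticking → Equivalence.from (Enabled×⇔ sh) (subst (EnabledAt (shape i e)) (sym y↦k) (Equivalence.from expire-enabled⇔ ticking)))

  Enabled-fire⇔ : ∀ {m i e y i' t b} → Shaped m (shape i e) → transOf y ≡ fire i' t b →
                  Enabled N× m y ⇔ (i' ≡ i × FireReady i e t b)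
  Enabled-fire⇔ {i = i} {e} sh y↦f = mk⇔
    (λ en → Equivalence.to fire-enabled⇔ (subst (EnabledAt (shape i e)) y↦f (Equivalence.to (Enabled×⇔ sh) en)))
    (λ ready → Equivalence.from (Enabled×⇔ sh) (subst (EnabledAt (shape i e)) (sym y↦f) (Equivalence.from fire-enabled⇔ ready)))

  fire-clock-stays-zero : ∀ {s x y x' y' i t b} → Related s x → Fire N× x y x' → Enabled N× (mk x') y' →
                          transOf y' ≡ fire i t b → φ x' y' ≡ 0ℚ
  fire-clock-stays-zero {s} {x} {y} {x'} {y'} R firing en y'↦f =
    Fire-keeps-zero-clock N× {x} {y} {x'} {y'} firing en (λ q → ∈zeroInterval ∘ subst (q ∈I_) (cong interval y'↦f))
      (trans (clocks R y') (cong (clock s) y'↦f))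

  fire-interval-zero : ∀ {y i t b q} → transOf y ≡ fire i t b → q ≡ 0ℚ → q ∈I TPN.Is N× y
  fire-interval-zero y↦f refl = subst (0ℚ ∈I_) (cong interval (sym y↦f)) 0∈zeroInterval

  -- Discrete steps

  Coherent-expireAt : ∀ {s i e k} → Coherent s i e → φ s k ≡ 0ℚ → Coherent s i (expireAt e k)
  Coherent-expireAt {s} {e = e} {k} coh φk≡0 = record
    { marking≗ = marking≗ coh
    ; expired-zero = λ k' h → [ expired-zero coh k' , (λ k'≡k → subst (λ k → φ s k ≡ 0ℚ) (sym (toWitness k'≡k)) φk≡0) ]′
                                 (Equivalence.to (BoolP.T-∨ {e k'}) h) }

  expire-Persistent : ∀ {s x y m' y' k k'} (R : Related s x) → transOf y ≡ expire k →
                      Shaped m' (shape (index R) (expireAt (expiry R) k)) → Enabled N× m' y' → transOf y' ≡ expire k' →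
                      Persistent N× (mk x) y y'
  expire-Persistent {k = k} {k'} R y↦k sh' en' y'↦k' =
    Equivalence.from (Persistent×-expire⇔ (shaped R) y'↦k' (λ y↦k' → k'≢k (expire-injective (trans (sym y↦k') y↦k))))
      (subst (λ a → 1 ≤ℕ shape (index R) (expiry R) (running k') ∸ pre a (running k')) (sym y↦k)
        (expire-keeps {index R} {expiry R} k'≢k ticking))
    where
    expire-injective : ∀ {k k'} → _≡_ {A = Trans} (expire k) (expire k') → k ≡ k'
    expire-injective refl = refl
    split : ¬ T ⌊ k' ≟ k ⌋ × Ticking (index R) (expiry R) k'
    split = ticking-expireAt _ (expiry R k') _ (Equivalence.to (Enabled-expire⇔ sh' y'↦k') en')
    k'≢k : k' ≢ k
    k'≢k = proj₁ split ∘ fromWitness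
    ticking : Ticking (index R) (expiry R) k'
    ticking = proj₂ split

  expire-Step⇔ : ∀ {s x y m' k} (R : Related s x) → transOf y ≡ expire k → Ticking (index R) (expiry R) k →
                 (∀ p → m' p ≡ mk x p ∸ TPN.Pre N× y p + TPN.Post N× y p) ⇔ Shaped m' (shape (index R) (expireAt (expiry R) k))
  expire-Step⇔ {k = k} R y↦k ticking = Step×⇔ (shaped R)
    (subst (λ a → ∀ q → shape i (expireAt e k) q ≡ shape i e q ∸ pre a q + post a q) (sym y↦k) (expire-balance ticking))
    where
    i : Fin L
    i = index R
    e : Fin nT → Bool
    e = expiry R

  expire-Fire : ∀ {s x k} (R : Related s x) (ticking : Ticking (index R) (expiry R) k) (φk≡0 : φ s k ≡ 0ℚ) →
                Fire N× x (transAt (expire k)) (image s (index R) (expireAt (expiry R) k) (Coherent-expireAt (coherent R) φk≡0))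
  expire-Fire {s} {x} {k} R ticking φk≡0 =
    Equivalence.from (Enabled-expire⇔ (shaped R) y↦k) ticking ,
    trans (clocks R y) (trans (cong (clock s) y↦k) φk≡0) ,
    Equivalence.from (expire-Step⇔ R y↦k ticking) (tokens λ _ → refl) ,
    conditions
    where
    y : Fin (TPN.nT N×)
    y = transAt (expire k)
    y↦k : transOf y ≡ expire k
    y↦k = transOf-transAt (expire k)
    sh₁ : Shaped (shape (index R) (expireAt (expiry R) k) ∘ placeOf) (shape (index R) (expireAt (expiry R) k))
    sh₁ = tokens λ _ → refl
    conditions : ∀ y' → Enabled N× (shape (index R) (expireAt (expiry R) k) ∘ placeOf) y' →
                 (Persistent N× (mk x) y y' → clock s (transOf y') ≡ φ x y') ×
                 (¬ Persistent N× (mk x) y y' → clock s (transOf y') ∈I TPN.Is N× y')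
    conditions y' en' = (λ _ → sym (clocks R y')) , not-persistent (transOf y') refl
      where
      not-persistent : ∀ a → transOf y' ≡ a → ¬ Persistent N× (mk x) y y' → clock s (transOf y') ∈I TPN.Is N× y'
      not-persistent (expire _) y'↦ ¬persistent = ⊥-elim (¬persistent (expire-Persistent R y↦k sh₁ en' y'↦))
      not-persistent (fire _ _ _) y'↦ _ = fire-interval-zero y'↦ (cong (clock s) y'↦)

  expire-Related : ∀ {s x y x' k} (R : Related s x) → transOf y ≡ expire k → Fire N× x y x' → Related s x'
  expire-Related {s} {x} {y} {x'} {k} R y↦k firing@(en , φ≡0 , step , conditions) = record
    { index = index R ; expiry = expireAt (expiry R) k ; reachable = reachable R
    ; coherent = coh' ; shaped = sh' ; clocks = clocks-from-enabled {x = x'} coh' sh' enabled-clocks }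
    where
    ticking : Ticking (index R) (expiry R) k
    ticking = Equivalence.to (Enabled-expire⇔ (shaped R) y↦k) en
    coh' : Coherent s (index R) (expireAt (expiry R) k)
    coh' = Coherent-expireAt (coherent R) (trans (sym (trans (clocks R y) (cong (clock s) y↦k))) φ≡0)
    sh' : Shaped (mk x') (shape (index R) (expireAt (expiry R) k))
    sh' = Equivalence.to (expire-Step⇔ R y↦k ticking) step
    enabled-clocks : ∀ y' → Enabled N× (mk x') y' → φ x' y' ≡ clock s (transOf y')
    enabled-clocks y' en' = by-transition (transOf y') refl
      where
      by-transition : ∀ a → transOf y' ≡ a → φ x' y' ≡ clock s a
      by-transition (expire _) y'↦ = trans (proj₁ (conditions y' en') (expire-Persistent R y↦k sh' en' y'↦))
                                       (trans (clocks R y') (cong (clock s) y'↦))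
      by-transition (fire _ _ _) y'↦ = fire-clock-stays-zero {x = x} {y} {x'} {y'} R firing en' y'↦

  label-just : ∀ a {t} → label a ≡ just t → ∃ λ i → ∃ λ b → a ≡ fire i t b
  label-just (fire i t b) refl = i , b , refl

  label-nothing : ∀ a → label a ≡ nothing → ∃ λ k → a ≡ expire k
  label-nothing (expire k) _ = k , refl

  fire≢expire : ∀ {i t b k} → _≢_ {A = Trans} (fire i t b) (expire k)
  fire≢expire ()

  ready-fromBits : ∀ {i e t} → T (enabledᵇ (marking i) t ∧ e t) → FireReady i e t (fromBits e)
  ready-fromBits {e = e} t-ready = t-ready , λ k _ → bits-fromBits e k

  FireReady⇒urgent : ∀ {s i e t b} → Coherent s i e → FireReady i e t b → Enabled N (mk s) t × φ s t ≡ 0ℚ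
  FireReady⇒urgent {i = i} {t = t} coh (t-ready , _) =
    let (en , et) = Equivalence.to (BoolP.T-∧ {enabledᵇ (marking i) t}) t-ready
    in Enabled-resp-≗ N (sym ∘ marking≗ coh) (toWitness en) , expired-zero coh t et

  module FireStep {s x y t b} (R : Related s x) (y↦f : transOf y ≡ fire (index R) t b)
                  (ready : FireReady (index R) (expiry R) t b) where

    i : Fin L
    i = index R

    e : Fin nT → Bool
    e = expiry R

    e' : Fin nT → Bool
    e' = inheritedExpiry i t e

    coh : Coherent s i e
    coh = coherent R

    bits≡ : ∀ k → T (discarded i t k) → bits b k ≡ e k
    bits≡ = proj₂ ready

    urgent : Enabled N (mk s) t × φ s t ≡ 0ℚ
    urgent = FireReady⇒urgent coh ready

    successor : ∃ λ j → target i t ≡ just j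
    successor = successor-index (reachable R) (marking≗ coh) (proj₁ urgent) (proj₂ urgent)

    j : Fin L
    j = proj₁ successor

    successorMarking : Marking N
    successorMarking p = mk s p ∸ Pre t p + Post t p

    successorMarking≗j : successorMarking ≗ marking j
    successorMarking≗j p = trans (cong (λ n → n ∸ Pre t p + Post t p) (marking≗ coh p)) (target-sound (proj₂ successor) p)

    Step⇔ : ∀ {m'} → (∀ p → m' p ≡ mk x p ∸ TPN.Pre N× y p + TPN.Post N× y p) ⇔ Shaped m' (shape j e')
    Step⇔ = Step×⇔ (shaped R)
      (subst (λ a → ∀ q → shape j e' q ≡ shape i e q ∸ pre a q + post a q) (sym y↦f) (fire-balance (proj₂ successor) ready))

    Coherent-after : ∀ {s'} → Fire N s t s' → Coherent s' j e'
    Coherent-after (_ , _ , step , conditions) = record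
      { marking≗ = λ p → trans (step p) (successorMarking≗j p)
      ; expired-zero = λ k h →
          let (pers , ek) = Equivalence.to (BoolP.T-∧ {persistsᵇ i t k}) h
              P : Persistent N (mk s) t k
              P = Persistent-resp-≗ N (sym ∘ marking≗ coh) (toWitness pers)
          in trans (proj₁ (conditions k (Enabled-resp-≗ N (sym ∘ step) (Persistent⇒Enabled-after N P))) P)
                   (expired-zero coh k ek)
      }

    keeps : ∀ {k} → (1 ≤ℕ shape i e (running k) ∸ pre (transOf y) (running k)) ≡
                    (1 ≤ℕ shape i e (running k) ∸ pre (fire i t b) (running k))
    keeps {k} = cong (λ a → 1 ≤ℕ shape i e (running k) ∸ pre a (running k)) y↦f

    Persistent⇒ : ∀ {y' k} → transOf y' ≡ expire k → Persistent N× (mk x) y y' → Persistent N (mk s) t k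
    Persistent⇒ y'↦k P× =
      Persistent-resp-≗ N (sym ∘ marking≗ coh)
        (toWitness (Equivalence.to (fire-keeps⇔ ticking bits≡)
          (subst id keeps (Equivalence.to (Persistent×-expire⇔ (shaped R) y'↦k (fire≢expire ∘ trans (sym y↦f))) P×))))
      where
      ticking : Ticking i e _
      ticking = Equivalence.to (Enabled-expire⇔ (shaped R) y'↦k) (proj₁ (proj₂ P×))

    Persistent⇐ : ∀ {y' k} → transOf y' ≡ expire k → Ticking i e k → Persistent N (mk s) t k → Persistent N× (mk x) y y'
    Persistent⇐ y'↦k ticking P =
      Equivalence.from (Persistent×-expire⇔ (shaped R) y'↦k (fire≢expire ∘ trans (sym y↦f)))
        (subst id (sym keeps) (Equivalence.from (fire-keeps⇔ ticking bits≡) (fromWitness (Persistent-resp-≗ N (marking≗ coh) P))))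

    image-conditions : ∀ {s'} → Fire N s t s' → (coh' : Coherent s' j e') →
                       ∀ y' → Enabled N× (shape j e' ∘ placeOf) y' →
                       (Persistent N× (mk x) y y' → clock s' (transOf y') ≡ φ x y') ×
                       (¬ Persistent N× (mk x) y y' → clock s' (transOf y') ∈I TPN.Is N× y')
    image-conditions {s'} (_ , _ , _ , conditions) coh' y' en' = by-transition (transOf y') refl
      where
      by-transition : ∀ a → transOf y' ≡ a →
                      (Persistent N× (mk x) y y' → clock s' (transOf y') ≡ φ x y') ×
                      (¬ Persistent N× (mk x) y y' → clock s' (transOf y') ∈I TPN.Is N× y')
      by-transition (expire k) y'↦k =
        (λ P× → trans (cong (clock s') y'↦k)
                  (trans (proj₁ (conditions k en-k) (Persistent⇒ y'↦k P×)) (sym (trans (clocks R y') (cong (clock s) y'↦k))))) ,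
        λ ¬P× → subst₂ _∈I_ (cong (clock s') (sym y'↦k)) (cong interval (sym y'↦k))
                  (proj₂ (conditions k en-k) λ P → ¬P× (Persistent⇐ y'↦k (ticking P) P))
        where
        ticking' : Ticking j e' k
        ticking' = Equivalence.to (Enabled-expire⇔ {i = j} {e'} (tokens λ _ → refl) y'↦k) en'
        en-k : Enabled N (mk s') k
        en-k = Ticking⇒Enabled {e = e'} (marking≗ coh') ticking'
        ticking : Persistent N (mk s) t k → Ticking i e k
        ticking P = inherited-ticking _ _ (persistsᵇ i t k) (e k) pers (persists⇒enabled pers) ticking'
          where
          pers : T (persistsᵇ i t k)
          pers = fromWitness (Persistent-resp-≗ N (marking≗ coh) P)
      by-transition (fire _ _ _) y'↦f =
        (λ _ → trans (cong (clock s') y'↦f) (sym (trans (clocks R y') (cong (clock s) y'↦f)))) ,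
        λ _ → fire-interval-zero y'↦f (cong (clock s') y'↦f)

    readClocks-conditions : ∀ {x'} → Fire N× x y x' → ∀ k → Enabled N successorMarking k →
                            (Persistent N (mk s) t k → φ (readClocks x' successorMarking) k ≡ φ s k) ×
                            (¬ Persistent N (mk s) t k → φ (readClocks x' successorMarking) k ∈I Is k)
    readClocks-conditions {x'} (_ , _ , step× , conditions×) k en-k =
      (λ P → trans (readClocks-enabled {x = x'} en-k) (persistent P (T? (e k)))) ,
      λ ¬P → subst₂ _∈I_ (sym (readClocks-enabled {x = x'} en-k)) (cong interval yk↦k)
               (proj₂ (conditions× yk (enabled-after (λ pers → ⊥-elim (¬P (toPersistent pers)))))
                 λ P× → ¬P (Persistent⇒ yk↦k P×))
      where
      yk : Fin (TPN.nT N×)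
      yk = transAt (expire k)
      yk↦k : transOf yk ≡ expire k
      yk↦k = transOf-transAt (expire k)
      sh' : Shaped (mk x') (shape j e')
      sh' = Equivalence.to Step⇔ step×
      toPersistent : T (persistsᵇ i t k) → Persistent N (mk s) t k
      toPersistent pers = Persistent-resp-≗ N (sym ∘ marking≗ coh) (toWitness pers)
      enabled-after : (T (persistsᵇ i t k) → ¬ T (e k)) → Enabled N× (mk x') yk
      enabled-after ¬both = Equivalence.from (Enabled-expire⇔ {i = j} {e'} sh' yk↦k)
        (inherited-ticking-intro _ (persistsᵇ i t k) (e k) (fromWitness (Enabled-resp-≗ N successorMarking≗j en-k)) ¬both)
      persistent : Persistent N (mk s) t k → Dec (T (e k)) → φ x' yk ≡ φ s k
      persistent P (yes ek) =
        trans (φ-dis x' yk λ en× → inherited-expired _ (persistsᵇ i t k) (e k) pers ek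
                                      (Equivalence.to (Enabled-expire⇔ {i = j} {e'} sh' yk↦k) en×))
          (sym (expired-zero coh k ek))
        where
        pers : T (persistsᵇ i t k)
        pers = fromWitness (Persistent-resp-≗ N (marking≗ coh) P)
      persistent P (no ¬ek) =
        trans (proj₁ (conditions× yk (enabled-after λ _ → ¬ek))
                 (Persistent⇐ yk↦k (ticking-intro _ (e k) (persists⇒enabled pers) ¬ek) P))
          (trans (clocks R yk) (cong (clock s) yk↦k))
        where
        pers : T (persistsᵇ i t k)
        pers = fromWitness (Persistent-resp-≗ N (marking≗ coh) P)

  fire-forward : ∀ {s x t s'} (R : Related s x) → T (expiry R t) → Fire N s t s' →
                 ∃ λ x' → LStep N N× lab x (vis t) x' × Related s' x'
  fire-forward {s} {x} {t} {s'} R t-expired firing@(en , _) =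
    image s' j e' coh' , (y , cong label y↦f , firing×) ,
    image-Related (Reachable-step N (reachable R) (inj₁ (t , firing))) coh'
    where
    y : Fin (TPN.nT N×)
    y = transAt (fire (index R) t (fromBits (expiry R)))
    y↦f : transOf y ≡ fire (index R) t (fromBits (expiry R))
    y↦f = transOf-transAt (fire (index R) t (fromBits (expiry R)))
    ready : FireReady (index R) (expiry R) t (fromBits (expiry R))
    ready = ready-fromBits (Equivalence.from BoolP.T-∧ (fromWitness (Enabled-resp-≗ N (marking≗ (coherent R)) en) , t-expired))
    open FireStep R y↦f ready
    coh' : Coherent s' j e'
    coh' = Coherent-after firing
    firing× : Fire N× x y (image s' j e' coh')
    firing× = Equivalence.from (Enabled-fire⇔ (shaped R) y↦f) (refl , ready) ,
              trans (clocks R y) (cong (clock s) y↦f) ,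
              Equivalence.from Step⇔ (tokens λ _ → refl) ,
              image-conditions firing coh'

  fire-backward : ∀ {s x y x' t b} (R : Related s x) → transOf y ≡ fire (index R) t b → FireReady (index R) (expiry R) t b →
                  Fire N× x y x' → ∃ λ s' → Fire N s t s' × Related s' x'
  fire-backward {s} {x} {y} {x'} {t} R y↦f ready firing×@(_ , _ , step× , _) =
    s' , firing , record
      { index = j ; expiry = e' ; reachable = Reachable-step N (reachable R) (inj₁ (t , firing))
      ; coherent = coh' ; shaped = sh' ; clocks = clocks-from-enabled {x = x'} coh' sh' enabled-clocks }
    where
    open FireStep R y↦f ready
    s' : State N
    s' = readClocks x' successorMarking
    firing : Fire N s t s'
    firing = proj₁ urgent , proj₂ urgent , (λ _ → refl) , readClocks-conditions {x'} firing×
    coh' : Coherent s' j e'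
    coh' = Coherent-after firing
    sh' : Shaped (mk x') (shape j e')
    sh' = Equivalence.to Step⇔ step×
    enabled-clocks : ∀ y' → Enabled N× (mk x') y' → φ x' y' ≡ clock s' (transOf y')
    enabled-clocks y' en' = by-transition (transOf y') refl
      where
      by-transition : ∀ a → transOf y' ≡ a → φ x' y' ≡ clock s' a
      by-transition (expire k) y'↦k =
        sym (trans (readClocks-enabled {x = x'} (Ticking⇒Enabled {e = e'} successorMarking≗j
                                                  (Equivalence.to (Enabled-expire⇔ {i = j} {e'} sh' y'↦k) en')))
               (cong (φ x') (trans (cong transAt (sym y'↦k)) (transAt-transOf y'))))
      by-transition (fire _ _ _) y'↦f = fire-clock-stays-zero {x = x} {y} {x'} {y'} R firing× en' y'↦f

  -- Delays and initial states

  expire-Enabled⇒Enabled : ∀ {s x y k} (R : Related s x) → transOf y ≡ expire k → Enabled N× (mk x) y → Enabled N (mk s) k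
  expire-Enabled⇒Enabled R y↦k en =
    Ticking⇒Enabled {e = expiry R} (marking≗ (coherent R)) (Equivalence.to (Enabled-expire⇔ (shaped R) y↦k) en)

  delay-Related : ∀ {s x s' x' θ} (R : Related s x) → Delay N s θ s' → Delay N× x θ x' → Related s' x'
  delay-Related {s} {x} {s'} {x'} {θ} R delayN@(_ , _ , same , shift) delay×@(_ , _ , same× , shift×) = record
    { index = index R ; expiry = expiry R ; reachable = Reachable-step N (reachable R) (inj₂ (θ , delayN))
    ; coherent = coh' ; shaped = sh' ; clocks = clocks-from-enabled {x = x'} coh' sh' enabled-clocks }
    where
    coh : Coherent s (index R) (expiry R)
    coh = coherent R
    expired-zero' : ∀ k → T (expiry R k) → φ s' k ≡ 0ℚ
    expired-zero' k ek with enabled? N (mk s) k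
    ... | yes en =
      trans (shift k en) (trans (cong₂ _-_ φk≡0 (Delay-enabled-zero N {s} {θ} {s'} {k} delayN en φk≡0)) (ℚP.+-identityʳ 0ℚ))
      where
      φk≡0 : φ s k ≡ 0ℚ
      φk≡0 = expired-zero coh k ek
    ... | no dis = φ-dis s' k (dis ∘ Enabled-resp-≗ N same)
    coh' : Coherent s' (index R) (expiry R)
    coh' = record { marking≗ = λ p → trans (same p) (marking≗ coh p) ; expired-zero = expired-zero' }
    sh' : Shaped (mk x') (shape (index R) (expiry R))
    sh' = tokens λ p → trans (same× p) (tokens≡ (shaped R) p)
    enabled-clocks : ∀ y → Enabled N× (mk x') y → φ x' y ≡ clock s' (transOf y)
    enabled-clocks y en' = trans (shift× y en) (by-transition (transOf y) refl)
      where
      en : Enabled N× (mk x) y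
      en = Enabled-resp-≗ N× same× en'
      by-transition : ∀ a → transOf y ≡ a → φ x y - θ ≡ clock s' a
      by-transition (expire k) y↦k =
        trans (cong (_- θ) (trans (clocks R y) (cong (clock s) y↦k)))
          (sym (shift k (expire-Enabled⇒Enabled R y↦k en)))
      by-transition (fire _ _ _) y↦f =
        trans (cong₂ _-_ φy≡0 (Delay-enabled-zero N× {x} {θ} {x'} {y} delay× en φy≡0)) (ℚP.+-identityʳ 0ℚ)
        where
        φy≡0 : φ x y ≡ 0ℚ
        φy≡0 = trans (clocks R y) (cong (clock s) y↦f)

  delay-forward : ∀ {s x s' θ} (R : Related s x) → Delay N s θ s' → ∃ λ x' → Delay N× x θ x' × Related s' x'
  delay-forward {s} {x} {s'} {θ} R delayN@(0≤θ , θ≤φ , _) =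
    proj₁ delayed , proj₂ delayed , delay-Related R delayN (proj₂ delayed)
    where
    bound : ∀ y → Enabled N× (mk x) y → θ ≤ℚ φ x y
    bound y en = subst (θ ≤ℚ_) (sym (clocks R y)) (by-transition (transOf y) refl)
      where
      by-transition : ∀ a → transOf y ≡ a → θ ≤ℚ clock s (transOf y)
      by-transition (expire k) y↦k = subst (θ ≤ℚ_) (cong (clock s) (sym y↦k))
        (θ≤φ k (expire-Enabled⇒Enabled R y↦k en))
      by-transition (fire _ t _) y↦f =
        let (en-t , φt≡0) = FireReady⇒urgent (coherent R) (proj₂ (Equivalence.to (Enabled-fire⇔ (shaped R) y↦f) en))
        in subst (θ ≤ℚ_) (trans φt≡0 (cong (clock s) (sym y↦f))) (θ≤φ t en-t)
    delayed : ∃ λ x' → Delay N× x θ x'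
    delayed = Delay-exists N× {x} 0≤θ bound

  delay-backward : ∀ {s x x' θ} (R : Related s x) → Delay N× x θ x' → ∃ λ s' → Delay N s θ s' × Related s' x'
  delay-backward {s} {x} {x'} {θ} R delay×@(0≤θ , θ≤φ× , _) =
    proj₁ delayed , proj₂ delayed , delay-Related R (proj₂ delayed) delay×
    where
    i : Fin L
    i = index R
    e : Fin nT → Bool
    e = expiry R
    bound : ∀ k → Enabled N (mk s) k → θ ≤ℚ φ s k
    bound k en = by-expiry (T? (e k))
      where
      en-i : T (enabledᵇ (marking i) k)
      en-i = fromWitness (Enabled-resp-≗ N (marking≗ (coherent R)) en)
      by-expiry : Dec (T (e k)) → θ ≤ℚ φ s k
      by-expiry (no ¬ek) =
        subst (θ ≤ℚ_) (trans (clocks R yk) (cong (clock s) yk↦k))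
          (θ≤φ× yk (Equivalence.from (Enabled-expire⇔ (shaped R) yk↦k) (ticking-intro _ (e k) en-i ¬ek)))
        where
        yk : Fin (TPN.nT N×)
        yk = transAt (expire k)
        yk↦k : transOf yk ≡ expire k
        yk↦k = transOf-transAt (expire k)
      by-expiry (yes ek) =
        subst (θ ≤ℚ_) (trans (trans (clocks R yf) (cong (clock s) yf↦f)) (sym (expired-zero (coherent R) k ek)))
          (θ≤φ× yf (Equivalence.from (Enabled-fire⇔ (shaped R) yf↦f)
                      (refl , ready-fromBits (Equivalence.from BoolP.T-∧ (en-i , ek)))))
        where
        yf : Fin (TPN.nT N×)
        yf = transAt (fire i k (fromBits e))
        yf↦f : transOf yf ≡ fire i k (fromBits e)
        yf↦f = transOf-transAt (fire i k (fromBits e))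
    delayed : ∃ λ s' → Delay N s θ s'
    delayed = Delay-exists N {s} 0≤θ bound

  no-fire-initially : ∀ {m y i t b} → Shaped m (shape i₀ noneExpired) → transOf y ≡ fire i t b → ¬ Enabled N× m y
  no-fire-initially {t = t} sh y↦f en =
    subst T (BoolP.∧-zeroʳ (enabledᵇ (marking i₀) t)) (proj₁ (proj₂ (Equivalence.to (Enabled-fire⇔ sh y↦f) en)))

  initial-forward : ∀ s → Initial N s → ∃ λ x → Initial N× x × Related s x
  initial-forward s init@(s≗m₀ , in-interval) =
    image s i₀ noneExpired coh , ((λ _ → refl) , in-interval×) , image-Related (s , init , ε) coh
    where
    coh : Coherent s i₀ noneExpired
    coh = record { marking≗ = λ p → trans (s≗m₀ p) (m₀≗marking-i₀ p) ; expired-zero = λ _ () }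
    in-interval× : ∀ y → Enabled N× (shape i₀ noneExpired ∘ placeOf) y → clock s (transOf y) ∈I interval (transOf y)
    in-interval× y en = by-transition (transOf y) refl
      where
      sh : Shaped (shape i₀ noneExpired ∘ placeOf) (shape i₀ noneExpired)
      sh = tokens λ _ → refl
      by-transition : ∀ a → transOf y ≡ a → clock s (transOf y) ∈I interval (transOf y)
      by-transition (expire k) y↦k = subst (λ a → clock s a ∈I interval a) (sym y↦k)
        (in-interval k (Ticking⇒Enabled {e = noneExpired} (marking≗ coh) (Equivalence.to (Enabled-expire⇔ sh y↦k) en)))
      by-transition (fire _ _ _) y↦f = ⊥-elim (no-fire-initially sh y↦f en)

  initial-backward : ∀ x → Initial N× x → ∃ λ s → Initial N s × Related s x
  initial-backward x init×@(x≗m₀ , in-interval×) =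
    s , init , record
      { index = i₀ ; expiry = noneExpired ; reachable = s , init , ε
      ; coherent = coh ; shaped = sh ; clocks = clocks-from-enabled {x = x} coh sh enabled-clocks }
    where
    s : State N
    s = readClocks x m₀
    sh : Shaped (mk x) (shape i₀ noneExpired)
    sh = tokens x≗m₀
    coh : Coherent s i₀ noneExpired
    coh = record { marking≗ = m₀≗marking-i₀ ; expired-zero = λ _ () }
    init : Initial N s
    init = (λ _ → refl) , λ k en →
      subst₂ _∈I_ (sym (readClocks-enabled {x = x} en)) (cong interval (transOf-transAt (expire k)))
        (in-interval× (transAt (expire k)) (Equivalence.from (Enabled-expire⇔ sh (transOf-transAt (expire k)))
          (ticking-intro _ false (fromWitness (Enabled-resp-≗ N m₀≗marking-i₀ en)) λ ())))
    enabled-clocks : ∀ y → Enabled N× (mk x) y → φ x y ≡ clock s (transOf y)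
    enabled-clocks y en = by-transition (transOf y) refl
      where
      by-transition : ∀ a → transOf y ≡ a → φ x y ≡ clock s a
      by-transition (expire k) y↦k =
        sym (trans (readClocks-enabled {x = x}
                     (Ticking⇒Enabled {e = noneExpired} (marking≗ coh) (Equivalence.to (Enabled-expire⇔ sh y↦k) en)))
               (cong (φ x) (trans (cong transAt (sym y↦k)) (transAt-transOf y))))
      by-transition (fire _ _ _) y↦f = ⊥-elim (no-fire-initially sh y↦f en)

  fire-forward-weak : ∀ {s x t s'} (R : Related s x) → Fire N s t s' →
                      ∃ λ x' → WeakStep (LStep N N× lab) x (vis t) x' × Related s' x'
  fire-forward-weak {s} {x} {t} R firing@(en , φt≡0 , _) with T? (expiry R t)
  ... | yes t-expired =
    let (x' , step , R') = fire-forward R t-expired firing in x' , (x , ε , step) , R'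
  ... | no ¬t-expired =
    let (x' , step , R') = fire-forward R₁ (Equivalence.from (BoolP.T-∨ {expiry R t}) (inj₂ (fromWitness refl))) firing
    in x' , (x₁ , (transAt (expire t) , cong label (transOf-transAt (expire t)) , expire-Fire R ticking φt≡0) ◅ ε , step) , R'
    where
    ticking : Ticking (index R) (expiry R) t
    ticking = ticking-intro _ (expiry R t) (fromWitness (Enabled-resp-≗ N (marking≗ (coherent R)) en)) ¬t-expired
    coh₁ : Coherent s (index R) (expireAt (expiry R) t)
    coh₁ = Coherent-expireAt (coherent R) φt≡0
    x₁ : State N×
    x₁ = image s (index R) (expireAt (expiry R) t) coh₁
    R₁ : Related s x₁
    R₁ = image-Related (reachable R) coh₁

  fire-backward-visible : ∀ {s x y x' t} (R : Related s x) → lab y ≡ just t → Fire N× x y x' →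
                          ∃ λ s' → Fire N s t s' × Related s' x'
  fire-backward-visible {y = y} R lab≡ firing× with label-just (transOf y) lab≡
  ... | _ , _ , y↦f with Equivalence.to (Enabled-fire⇔ (shaped R) y↦f) (proj₁ firing×)
  ...   | refl , ready = fire-backward R y↦f ready firing×

  simulation : WeakTimedSim (NStep N) (LStep N N× lab) Related
  simulation s x (vis t) s' R firing = fire-forward-weak R firing
  simulation s x (delay θ) s' R delayN =
    let (x' , delay× , R') = delay-forward R delayN in x' , (x , ε , delay×) , R'

  simulation⁻¹ : WeakTimedSim (LStep N N× lab) (NStep N) (λ x s → Related s x)
  simulation⁻¹ x s (vis t) x' R (_ , lab≡ , firing×) =
    let (s' , firing , R') = fire-backward-visible R lab≡ firing× in s' , (s , ε , firing) , R'
  simulation⁻¹ x s τ x' R (y , lab≡ , firing×) = s , ε , expire-Related R (proj₂ (label-nothing (transOf y) lab≡)) firing×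
  simulation⁻¹ x s (delay θ) x' R delay× =
    let (s' , delayN , R') = delay-backward R delay× in s' , (s , ε , delayN) , R'

  shape≤1 : ∀ i e q → shape i e q ≤ℕ 1
  shape≤1 i e (control i') = iverson≤1 _
  shape≤1 i e (running k) = iverson≤1 _
  shape≤1 i e (expired k) = iverson≤1 _

  oneSafe : OneSafe N×
  oneSafe x reach p =
    let (_ , R) = Reachable-related {lab = lab} simulation⁻¹ (λ x₀ init → map₂ proj₂ (initial-backward x₀ init)) x reach
    in subst (_≤ℕ 1) (sym (tokens≡ (shaped R) p)) (shape≤1 (index R) (expiry R) (placeOf p))

mainTheorem2 : (N : TPN) → FiniteReachableMarkings N →
    Σ TPN λ N× → Σ (Fin (TPN.nT N×) → Maybe (Fin (TPN.nT N))) λ lab →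
      OneSafe N× × WeakTimedBisimilar N N× lab
mainTheorem2 N finite = N× , lab , oneSafe , Related , simulation , simulation⁻¹ , initial-forward , initial-backward
  where open Construction N finite
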